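{- Let $M$ and $N$ be matroids on a finite set $E$ such that $N$ is a cyclic reduction of $M$, and let $F$ be a flat of $N$ of rank $k$. Then $A_M(F)\setminus W_M(F)=\{\mathrm{cyc}_N(F)\}$. Furthermore, $F$ is a flat of $M$ of rank $k$ if and only if $W_M(F)=\emptyset$.
   Context: For a flat $F$ of a matroid $N$, $\mathrm{cyc}_N(F)$ is the union of all circuits of $N$ contained in $F$. A flat is cyclic if it equals its cyclic part; $\mathcal{Z}(M)$ denotes the set of cyclic flats of $M$. $N$ is a cyclic reduction of $M$ if $\{\emptyset,\mathrm{cyc}_M(E)\}\subseteq \mathcal{Z}(N)\subseteq \mathcal{Z}(M)$ and $\mathrm{rank}_N(Z)=\mathrm{rank}_M(Z)$ for all $Z\in\mathcal{Z}(N)$. The nullity is $\mathrm{null}_N(F)=|F|-\mathrm{rank}_N(F)$. For a flat $F$ of $N$, $A_M(F)$ (abundant flats) is the set of $Z\in\mathcal{Z}(M)$ with $|Z\cap F|\ge \mathrm{null}_N(F)+\mathrm{rank}_M(Z)$, and $W_M(F)$ (witness flats) is the set of $Z\in A_M(F)$ with $Z\notin\mathcal{Z}(N)$. -}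

module Defs where

open import Data.Nat using (ℕ; _≤_; _<_; _+_; _∸_)
open import Data.Fin using (Fin)
open import Data.Fin.Subset using (Subset; _∈_; _∉_; _⊆_; _⊂_; _∪_; _∩_; ⁅_⁆; ⊤; ⊥; ∣_∣)
open import Data.Product using (Σ; _×_)
open import Relation.Binary.PropositionalEquality using (_≡_)
open import Relation.Nullary using (¬_)

record Matroid (n : ℕ) : Set where
  field
    rank        : Subset n → ℕ
    rank-≤-card : ∀ X → rank X ≤ ∣ X ∣
    rank-mono   : ∀ X Y → X ⊆ Y → rank X ≤ rank Y
    rank-submod : ∀ X Y → rank (X ∪ Y) + rank (X ∩ Y) ≤ rank X + rank Y
open Matroid public

module _ {n : ℕ} (M : Matroid n) where

  Independent : Subset n → Set
  Independent X = rank M X ≡ ∣ X ∣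

  Circuit : Subset n → Set
  Circuit C = ¬ Independent C × (∀ D → D ⊂ C → Independent D)

  Flat : Subset n → Set
  Flat F = ∀ e → e ∉ F → rank M F < rank M (F ∪ ⁅ e ⁆)

  -- IsCyc F Z : Z = cyc_M(F), the union of all circuits of M contained in F
  IsCyc : Subset n → Subset n → Set
  IsCyc F Z = ∀ e → (e ∈ Z → Σ (Subset n) λ C → Circuit C × C ⊆ F × e ∈ C)
                  × ((C : Subset n) → Circuit C → C ⊆ F → e ∈ C → e ∈ Z)

  CyclicFlat : Subset n → Set
  CyclicFlat Z = Flat Z × IsCyc Z Z

  nullity : Subset n → ℕ
  nullity X = ∣ X ∣ ∸ rank M X

CyclicReduction : {n : ℕ} → Matroid n → Matroid n → Set
CyclicReduction {n} N M =
    CyclicFlat N ⊥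
  × (∀ Z → IsCyc M ⊤ Z → CyclicFlat N Z)
  × (∀ Z → CyclicFlat N Z → CyclicFlat M Z)
  × (∀ Z → CyclicFlat N Z → rank N Z ≡ rank M Z)

Abundant : {n : ℕ} → Matroid n → Matroid n → Subset n → Subset n → Set
Abundant M N F Z = CyclicFlat M Z × nullity N F + rank M Z ≤ ∣ Z ∩ F ∣

Witness : {n : ℕ} → Matroid n → Matroid n → Subset n → Subset n → Set
Witness M N F Z = Abundant M N F Z × ¬ CyclicFlat N Z

module Submission where

-- Two facts about one matroid carry it:
--   * rank formula: every X has a cyclic flat Z with r Z + |X ─ Z| ≤ r X;
--   * abundance: for a flat F, a cyclic Z with null(F) + r Z ≤ |Z ∩ F| is
--     cyc F, and cyc F itself satisfies this inequality.
-- We first derive these from the rank axioms (coloops, circuits through a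
-- spanned element, cyc Y as the non-coloops of Y, closure), then treat the
-- reduction: the rank formula for N gives rank_M ≤ rank_N; abundance in N
-- identifies the abundant non-witnesses with C; abundance in M shows that a
-- flat F of M of the same rank has no witnesses; conversely, the rank
-- formula of M at F and F ∪ {e} shows that without witnesses F keeps its
-- rank and stays closed in M.

open import Defs
open import Data.Nat using (ℕ)
open import Data.Fin.Subset using (Subset)
open import Data.Product using (_×_)
open import Relation.Binary.PropositionalEquality using (_≡_)
open import Relation.Nullary using (¬_)
open import Function.Bundles using (_⇔_)

open import Data.Nat using (zero; suc; _+_; _∸_; _≤_; _<_; _≤?_)
open import Data.Nat.Properties
import Data.Bool.Properties as Bool
open import Data.Fin using (Fin)
import Data.Fin.Properties as Fin
open import Data.Fin.Subset using (inside; outside; _∈_; _∉_; _⊆_; _⊂_; _∪_; _∩_; _─_; _-_; ⁅_⁆; ∣_∣)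
open import Data.Fin.Subset.Properties
open import Data.Vec.Base using (tabulate; _∷_; []; here; there)
open import Data.Vec.Properties using (lookup∘tabulate; []=⇒lookup; lookup⇒[]=; ≡-dec)
open import Data.Product using (Σ; _,_; proj₁; proj₂; uncurry)
open import Data.Sum using (_⊎_; inj₁; inj₂; [_,_]′)
open import Function using (id)
open import Function.Bundles using (mk⇔; Equivalence)
open import Relation.Binary.PropositionalEquality using (_≢_; refl; sym; trans; cong; subst)
open import Relation.Nullary using (Dec; yes; no; ¬?; contradiction)
open import Relation.Nullary.Decidable using (⌊_⌋; toWitness; fromWitness; _×-dec_; decidable-stable)
open import Relation.Unary using (Decidable)

private variable
  n : ℕ

x∈p─q⁻ : ∀ {x : Fin n} (p q : Subset n) → x ∈ p ─ q → x ∈ p × x ∉ q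
x∈p─q⁻ p q h = p─q⊆p p q h , outside-q p q h
  where
  outside-q : ∀ {m} {x : Fin m} (p q : Subset m) → x ∈ p ─ q → x ∉ q
  outside-q (_ ∷ p) (inside ∷ q) () here
  outside-q (_ ∷ p) (_ ∷ q) (there h) (there k) = outside-q p q h k

─-monoˡ : ∀ {p q s : Subset n} → p ⊆ q → p ─ s ⊆ q ─ s
─-monoˡ {p = p} {s = s} p⊆q h = let (x∈p , x∉s) = x∈p─q⁻ p s h in x∈p∧x∉q⇒x∈p─q (p⊆q x∈p) x∉s

∣∩∣+∣─∣ : ∀ (p q : Subset n) → ∣ q ∩ p ∣ + ∣ p ─ q ∣ ≡ ∣ p ∣
∣∩∣+∣─∣ []            []            = refl
∣∩∣+∣─∣ (inside ∷ p)  (inside ∷ q)  = cong suc (∣∩∣+∣─∣ p q)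
∣∩∣+∣─∣ (inside ∷ p)  (outside ∷ q) = trans (+-suc _ _) (cong suc (∣∩∣+∣─∣ p q))
∣∩∣+∣─∣ (outside ∷ p) (inside ∷ q)  = ∣∩∣+∣─∣ p q
∣∩∣+∣─∣ (outside ∷ p) (outside ∷ q) = ∣∩∣+∣─∣ p q

⊆⇒∣∣+∣─∣ : ∀ {p q : Subset n} → q ⊆ p → ∣ q ∣ + ∣ p ─ q ∣ ≡ ∣ p ∣
⊆⇒∣∣+∣─∣ {p = p} {q} q⊆p = trans (cong (λ s → ∣ s ∣ + ∣ p ─ q ∣) (sym q∩p≡q)) (∣∩∣+∣─∣ p q)
  where
  q∩p≡q : q ∩ p ≡ q
  q∩p≡q = ⊆-antisym (p∩q⊆p q p) (λ h → x∈p∩q⁺ (h , q⊆p h))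

∣p-x∣ : ∀ {x : Fin n} {p : Subset n} → x ∈ p → suc ∣ p - x ∣ ≡ ∣ p ∣
∣p-x∣ {p = inside ∷ p} here = cong suc (cong ∣_∣ (p─⊥≡p p))
∣p-x∣ {x = Fin.suc x} {p = inside ∷ p} (there h) = cong suc (∣p-x∣ h)
∣p-x∣ {x = Fin.suc x} {p = outside ∷ p} (there h) = ∣p-x∣ h

⊆-─⁅⁆ : ∀ {x : Fin n} {p q : Subset n} → q ⊆ p → x ∉ q → q ⊆ p - x
⊆-─⁅⁆ {x = x} {q = q} q⊆p x∉q h =
  x∈p∧x∉q⇒x∈p─q (q⊆p h) (λ y∈⁅x⁆ → x∉q (subst (_∈ q) (x∈⁅y⁆⇒x≡y x y∈⁅x⁆) h))

x∈p∪⁅x⁆ : ∀ {x : Fin n} {p : Subset n} → x ∈ p ∪ ⁅ x ⁆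
x∈p∪⁅x⁆ {x = x} = x∈p∪q⁺ (inj₂ (x∈⁅x⁆ x))

∪⁅⁆⊆ : ∀ {x : Fin n} {p q : Subset n} → x ∈ q → p ⊆ q → p ∪ ⁅ x ⁆ ⊆ q
∪⁅⁆⊆ {x = x} {p} {q} x∈q p⊆q h with x∈p∪q⁻ p ⁅ x ⁆ h
... | inj₁ y∈p    = p⊆q y∈p
... | inj₂ y∈⁅x⁆ = subst (_∈ q) (sym (x∈⁅y⁆⇒x≡y x y∈⁅x⁆)) x∈q

select : {P : Fin n → Set} → Decidable P → Subset n
select P? = tabulate (λ x → ⌊ P? x ⌋)

select⁻ : {P : Fin n → Set} (P? : Decidable P) {x : Fin n} → x ∈ select P? → P x
select⁻ P? {x} h =
  toWitness (Equivalence.from Bool.T-≡ (trans (sym (lookup∘tabulate _ x)) ([]=⇒lookup h)))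

select⁺ : {P : Fin n → Set} (P? : Decidable P) {x : Fin n} → P x → x ∈ select P?
select⁺ P? {x} p =
  lookup⇒[]= x _ (trans (lookup∘tabulate _ x) (Equivalence.to Bool.T-≡ (fromWitness p)))

subset-ind : (P : Subset n → Set) → (∀ S → (∀ {s} → s ∈ S → P (S - s)) → P S) → ∀ S → P S
subset-ind P step S = go ∣ S ∣ S ≤-refl
  where
  go : ∀ m S → ∣ S ∣ ≤ m → P S
  go zero    S bound = step S (λ s∈S → contradiction (≤-trans (x∈p⇒∣p-x∣<∣p∣ s∈S) bound) n≮0)
  go (suc m) S bound = step S (λ {s} s∈S → go m (S - s) (≤-pred (≤-trans (x∈p⇒∣p-x∣<∣p∣ s∈S) bound)))

-- Matroid theory from the rank axioms, for a single matroid M.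

module _ {n : ℕ} (M : Matroid n) where

  private
    r : Subset n → ℕ
    r = rank M

  rank-⊆ : ∀ {X Y} → X ⊆ Y → r X ≤ r Y
  rank-⊆ {X} {Y} = rank-mono M X Y

  submod-⊆ : ∀ {A B P Q} → P ⊆ A ∪ B → Q ⊆ A ∩ B → r P + r Q ≤ r A + r B
  submod-⊆ {A} {B} P⊆ Q⊆ = ≤-trans (+-mono-≤ (rank-⊆ P⊆) (rank-⊆ Q⊆)) (rank-submod M A B)

  rank-split : ∀ X Z → r X ≤ r (Z ∩ X) + ∣ X ─ Z ∣
  rank-split X Z = begin
    r X                                          ≤⟨ rank-⊆ X⊆ ⟩
    r ((Z ∩ X) ∪ (X ─ Z))                        ≤⟨ m≤m+n _ _ ⟩
    r ((Z ∩ X) ∪ (X ─ Z)) + r ((Z ∩ X) ∩ (X ─ Z)) ≤⟨ rank-submod M _ _ ⟩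
    r (Z ∩ X) + r (X ─ Z)                        ≤⟨ +-monoʳ-≤ _ (rank-≤-card M _) ⟩
    r (Z ∩ X) + ∣ X ─ Z ∣                        ∎
    where
    open ≤-Reasoning
    X⊆ : X ⊆ (Z ∩ X) ∪ (X ─ Z)
    X⊆ {x} h with x ∈? Z
    ... | yes x∈Z = x∈p∪q⁺ (inj₁ (x∈p∩q⁺ (x∈Z , h)))
    ... | no  x∉Z = x∈p∪q⁺ (inj₂ (x∈p∧x∉q⇒x∈p─q h x∉Z))

  rank-≤ : ∀ X Z → r X ≤ r Z + ∣ X ─ Z ∣
  rank-≤ X Z = ≤-trans (rank-split X Z) (+-monoˡ-≤ _ (rank-⊆ (p∩q⊆p Z X)))

  independent-⊆ : ∀ {Y D} → Independent M Y → D ⊆ Y → Independent M D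
  independent-⊆ {Y} {D} indep-Y D⊆Y =
    ≤-antisym (rank-≤-card M D) (+-cancelʳ-≤ ∣ Y ─ D ∣ _ _ (begin
      ∣ D ∣ + ∣ Y ─ D ∣ ≡⟨ ⊆⇒∣∣+∣─∣ D⊆Y ⟩
      ∣ Y ∣             ≡⟨ sym indep-Y ⟩
      r Y               ≤⟨ rank-≤ Y D ⟩
      r D + ∣ Y ─ D ∣   ∎))
    where open ≤-Reasoning

  Coloop : Subset n → Fin n → Set
  Coloop Y e = r (Y - e) < r Y

  NonColoop : Subset n → Fin n → Set
  NonColoop Y e = r Y ≤ r (Y - e)

  -- In a circuit every element is spanned by the others: C - e is independent
  -- and C is not.
  circuit⇒nonColoop : ∀ {C e} → Circuit M C → e ∈ C → NonColoop C e
  circuit⇒nonColoop {C} {e} (dependent , minimal) e∈C = begin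
    r C       ≤⟨ ≤-pred (≤-trans (≤∧≢⇒< (rank-≤-card M C) dependent) (≤-reflexive (sym (∣p-x∣ e∈C)))) ⟩
    ∣ C - e ∣ ≡⟨ sym (minimal (C - e) (x∈p⇒p-x⊂p e∈C)) ⟩
    r (C - e) ∎
    where open ≤-Reasoning

  nonColoop-⊆ : ∀ {X Y e} → X ⊆ Y → e ∈ X → NonColoop X e → NonColoop Y e
  nonColoop-⊆ {X} {Y} {e} X⊆Y e∈X spanned = +-cancelʳ-≤ (r X) _ _ (begin
    r Y + r X       ≤⟨ +-monoʳ-≤ (r Y) spanned ⟩
    r Y + r (X - e) ≤⟨ submod-⊆ Y⊆ X-e⊆ ⟩
    r (Y - e) + r X ∎)
    where
    open ≤-Reasoning
    Y⊆ : Y ⊆ (Y - e) ∪ X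
    Y⊆ {y} h with y ∈? X
    ... | yes y∈X = x∈p∪q⁺ (inj₂ y∈X)
    ... | no  y∉X = x∈p∪q⁺ (inj₁ (x∈p∧x≢y⇒x∈p-y h (λ y≡e → y∉X (subst (_∈ X) (sym y≡e) e∈X))))
    X-e⊆ : X - e ⊆ (Y - e) ∩ X
    X-e⊆ h = x∈p∩q⁺ (─-monoˡ X⊆Y h , p─q⊆p X ⁅ e ⁆ h)

  coloop-⊆ : ∀ {X Y e} → X ⊆ Y → e ∈ X → Coloop Y e → Coloop X e
  coloop-⊆ X⊆Y e∈X coloop = ≰⇒> (λ spanned → <⇒≱ coloop (nonColoop-⊆ X⊆Y e∈X spanned))

  coloops-deletion : ∀ Y S → (∀ {s} → s ∈ S → s ∈ Y × Coloop Y s) → r (Y ─ S) + ∣ S ∣ ≤ r Y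
  coloops-deletion Y = subset-ind P step
    where
    P : Subset n → Set
    P S = (∀ {s} → s ∈ S → s ∈ Y × Coloop Y s) → r (Y ─ S) + ∣ S ∣ ≤ r Y
    step : ∀ S → (∀ {s} → s ∈ S → P (S - s)) → P S
    step S ih coloops with nonempty? S
    ... | no S-empty rewrite Empty-unique S-empty | ∣⊥∣≡0 n | p─⊥≡p Y | +-identityʳ (r Y) = ≤-refl
    ... | yes (s , s∈S) = begin
      r (Y ─ S) + ∣ S ∣           ≡⟨ cong (r (Y ─ S) +_) (sym (∣p-x∣ s∈S)) ⟩
      r (Y ─ S) + suc ∣ S - s ∣   ≡⟨ +-suc _ _ ⟩
      suc (r (Y ─ S)) + ∣ S - s ∣ ≤⟨ +-monoˡ-≤ _ drop ⟩
      r (Y ─ S′) + ∣ S - s ∣      ≤⟨ ih s∈S (λ h → coloops (p─q⊆p S ⁅ s ⁆ h)) ⟩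
      r Y                         ∎
      where
      open ≤-Reasoning
      S′ = S - s
      Y─S⊆ : Y ─ S ⊆ Y ─ S′
      Y─S⊆ h = let (y∈Y , y∉S) = x∈p─q⁻ Y S h in x∈p∧x∉q⇒x∈p─q y∈Y (λ y∈S′ → y∉S (p─q⊆p S ⁅ s ⁆ y∈S′))
      s∈Y─S′ : s ∈ Y ─ S′
      s∈Y─S′ = x∈p∧x∉q⇒x∈p─q (proj₁ (coloops s∈S)) (λ h → proj₂ (x∈p─q⁻ S ⁅ s ⁆ h) (x∈⁅x⁆ s))
      drop : r (Y ─ S) < r (Y ─ S′)
      drop = ≤-<-trans (rank-⊆ (⊆-─⁅⁆ Y─S⊆ (λ h → proj₂ (x∈p─q⁻ Y S h) s∈S)))
                       (coloop-⊆ (p─q⊆p Y S′) s∈Y─S′ (proj₂ (coloops s∈S)))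

  coloops⇒independent : ∀ Y → (∀ {s} → s ∈ Y → Coloop Y s) → Independent M Y
  coloops⇒independent Y coloops = ≤-antisym (rank-≤-card M Y)
    (≤-trans (m≤n+m ∣ Y ∣ _) (coloops-deletion Y Y (λ s∈Y → s∈Y , coloops s∈Y)))

  coloop-extends : ∀ {Y e} → e ∈ Y → Coloop Y e → Independent M (Y - e) → Independent M Y
  coloop-extends {Y} {e} e∈Y coloop indep = ≤-antisym (rank-≤-card M Y) (begin
    ∣ Y ∣           ≡⟨ sym (∣p-x∣ e∈Y) ⟩
    suc ∣ Y - e ∣   ≡⟨ cong suc (sym indep) ⟩
    suc (r (Y - e)) ≤⟨ coloop ⟩
    r Y             ∎)
    where open ≤-Reasoning

  -- If X spans e ∈ X but X - f does not, for every other f ∈ X, then X is a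
  -- circuit: X - e consists of coloops, hence is independent, and so is every
  -- X - f.
  minimal⇒circuit : ∀ {X e} → e ∈ X → NonColoop X e →
                    (∀ {f} → f ∈ X → f ≢ e → Coloop (X - f) e) → Circuit M X
  minimal⇒circuit {X} {e} e∈X spanned tight = dependent , proper⇒independent
    where
    X-e-independent : Independent M (X - e)
    X-e-independent = coloops⇒independent (X - e) coloop
      where
      coloop : ∀ {f} → f ∈ X - e → Coloop (X - e) f
      coloop {f} f∈X-e = ≰⇒> λ spanned-f → <⇒≱ (tight f∈X f≢e) (begin
        r (X - f)     ≤⟨ rank-⊆ (p─q⊆p X ⁅ f ⁆) ⟩
        r X           ≤⟨ spanned ⟩
        r (X - e)     ≤⟨ spanned-f ⟩
        r (X - e - f) ≡⟨ cong r (p─x─y≡p─y─x X e f) ⟩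
        r (X - f - e) ∎)
        where
        open ≤-Reasoning
        f∈X = proj₁ (x∈p─q⁻ X ⁅ e ⁆ f∈X-e)
        f≢e = x∉⁅y⁆⇒x≢y (proj₂ (x∈p─q⁻ X ⁅ e ⁆ f∈X-e))
    dependent : ¬ Independent M X
    dependent indep = <-irrefl refl (begin-strict
      r X       ≤⟨ spanned ⟩
      r (X - e) ≡⟨ X-e-independent ⟩
      ∣ X - e ∣ <⟨ x∈p⇒∣p-x∣<∣p∣ e∈X ⟩
      ∣ X ∣     ≡⟨ sym indep ⟩
      r X       ∎)
      where open ≤-Reasoning
    proper⇒independent : ∀ D → D ⊂ X → Independent M D
    proper⇒independent D (D⊆X , g , g∈X , g∉D) with g Fin.≟ e
    ... | yes refl = independent-⊆ X-e-independent (⊆-─⁅⁆ D⊆X g∉D)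
    ... | no  g≢e  = independent-⊆ X-g-independent (⊆-─⁅⁆ D⊆X g∉D)
      where
      X-g-independent : Independent M (X - g)
      X-g-independent = coloop-extends (x∈p∧x≢y⇒x∈p-y e∈X (λ e≡g → g≢e (sym e≡g))) (tight g∈X g≢e)
        (independent-⊆ X-e-independent (─-monoˡ (p─q⊆p X ⁅ g ⁆)))

  -- A spanned element lies on a circuit: shrink X while e stays spanned.
  circuit-through : ∀ X {e} → e ∈ X → NonColoop X e → Σ (Subset n) λ C → Circuit M C × C ⊆ X × e ∈ C
  circuit-through = subset-ind P step
    where
    P : Subset n → Set
    P X = ∀ {e} → e ∈ X → NonColoop X e → Σ (Subset n) λ C → Circuit M C × C ⊆ X × e ∈ C
    step : ∀ X → (∀ {f} → f ∈ X → P (X - f)) → P X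
    step X ih {e} e∈X spanned
      with Fin.any? (λ f → f ∈? X ×-dec ¬? (f Fin.≟ e) ×-dec r (X - f) ≤? r (X - f - e))
    ... | yes (f , f∈X , f≢e , spanned-f) =
      let (C , circuit , C⊆ , e∈C) = ih f∈X (x∈p∧x≢y⇒x∈p-y e∈X (λ e≡f → f≢e (sym e≡f))) spanned-f
      in C , circuit , (λ h → p─q⊆p X ⁅ f ⁆ (C⊆ h)) , e∈C
    ... | no none = X , minimal⇒circuit e∈X spanned tight , id , e∈X
      where
      tight : ∀ {f} → f ∈ X → f ≢ e → Coloop (X - f) e
      tight f∈X f≢e = ≰⇒> (λ spanned-f → none (_ , f∈X , f≢e , spanned-f))

  cyc : Subset n → Subset n
  cyc Y = select (λ e → e ∈? Y ×-dec r Y ≤? r (Y - e))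

  cyc⁻ : ∀ {Y e} → e ∈ cyc Y → e ∈ Y × NonColoop Y e
  cyc⁻ {Y} = select⁻ (λ e → e ∈? Y ×-dec r Y ≤? r (Y - e))

  cyc⁺ : ∀ {Y e} → e ∈ Y → NonColoop Y e → e ∈ cyc Y
  cyc⁺ {Y} e∈Y spanned = select⁺ (λ e → e ∈? Y ×-dec r Y ≤? r (Y - e)) (e∈Y , spanned)

  cyc⊆ : ∀ {Y} → cyc Y ⊆ Y
  cyc⊆ h = proj₁ (cyc⁻ h)

  rank-cyc : ∀ Y → r (cyc Y) + ∣ Y ─ cyc Y ∣ ≡ r Y
  rank-cyc Y = ≤-antisym
    (≤-trans (+-monoˡ-≤ _ (rank-⊆ cyc⊆rest)) (coloops-deletion Y (Y ─ cyc Y) outside-coloop))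
    (rank-≤ Y (cyc Y))
    where
    outside-coloop : ∀ {s} → s ∈ Y ─ cyc Y → s ∈ Y × Coloop Y s
    outside-coloop h = let (s∈Y , s∉cyc) = x∈p─q⁻ Y (cyc Y) h in
      s∈Y , ≰⇒> (λ spanned → s∉cyc (cyc⁺ s∈Y spanned))
    cyc⊆rest : cyc Y ⊆ Y ─ (Y ─ cyc Y)
    cyc⊆rest h = x∈p∧x∉q⇒x∈p─q (cyc⊆ h) (λ h′ → proj₂ (x∈p─q⁻ Y (cyc Y) h′) h)

  circuit⊆cyc : ∀ {C Y} → Circuit M C → C ⊆ Y → C ⊆ cyc Y
  circuit⊆cyc circuit C⊆Y e∈C = cyc⁺ (C⊆Y e∈C) (nonColoop-⊆ C⊆Y e∈C (circuit⇒nonColoop circuit e∈C))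

  cyc-isCyc : ∀ Y → IsCyc M Y (cyc Y)
  cyc-isCyc Y e = (λ h → let (e∈Y , spanned) = cyc⁻ h in circuit-through Y e∈Y spanned)
                , (λ C circuit C⊆Y e∈C → circuit⊆cyc circuit C⊆Y e∈C)

  isCyc⇒≡cyc : ∀ {Y Z} → IsCyc M Y Z → Z ≡ cyc Y
  isCyc⇒≡cyc {Y} {Z} Z-isCyc = ⊆-antisym
    (λ {e} h → let (C , circuit , C⊆Y , e∈C) = proj₁ (Z-isCyc e) h in circuit⊆cyc circuit C⊆Y e∈C)
    (λ {e} h → let (C , circuit , C⊆Y , e∈C) = proj₁ (cyc-isCyc Y e) h in proj₂ (Z-isCyc e) C circuit C⊆Y e∈C)

  cyc-cyclicFlat : ∀ {G} → Flat M G → CyclicFlat M (cyc G)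
  cyc-cyclicFlat {G} flat-G = flat , cyclic
    where
    cyclic : IsCyc M (cyc G) (cyc G)
    cyclic e = (λ h → let (C , circuit , C⊆G , e∈C) = proj₁ (cyc-isCyc G e) h in
                      C , circuit , circuit⊆cyc circuit C⊆G , e∈C)
             , (λ C circuit C⊆ e∈C → circuit⊆cyc circuit (λ h → cyc⊆ (C⊆ h)) e∈C)
    flat : Flat M (cyc G)
    flat e e∉cyc with e ∈? G
    -- outside G, e raises the rank of G and hence, by submodularity, of cyc G
    ... | no e∉G = +-cancelʳ-≤ (r G) _ _ (begin
      suc (r (cyc G)) + r G         ≡⟨ sym (+-suc _ _) ⟩
      r (cyc G) + suc (r G)         ≤⟨ +-monoʳ-≤ _ (flat-G e e∉G) ⟩
      r (cyc G) + r (G ∪ ⁅ e ⁆)     ≡⟨ +-comm (r (cyc G)) _ ⟩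
      r (G ∪ ⁅ e ⁆) + r (cyc G)     ≤⟨ submod-⊆ (∪⁅⁆⊆ (x∈p∪q⁺ (inj₁ x∈p∪⁅x⁆)) (q⊆p∪q _ G))
                                                 (λ h → x∈p∩q⁺ (p⊆p∪q ⁅ e ⁆ h , cyc⊆ h)) ⟩
      r (cyc G ∪ ⁅ e ⁆) + r G       ∎)
      where open ≤-Reasoning
    -- inside G, e is a coloop of G and hence of cyc G ∪ {e} ⊆ G
    ... | yes e∈G = ≤-<-trans (rank-⊆ (⊆-─⁅⁆ (p⊆p∪q ⁅ e ⁆) e∉cyc))
                              (coloop-⊆ (∪⁅⁆⊆ e∈G cyc⊆) x∈p∪⁅x⁆ coloop-G)
      where
      coloop-G : Coloop G e
      coloop-G = ≰⇒> (λ spanned → e∉cyc (cyc⁺ e∈G spanned))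

  spans-union : ∀ X S → (∀ {s} → s ∈ S → r (X ∪ ⁅ s ⁆) ≤ r X) → r (X ∪ S) ≤ r X
  spans-union X = subset-ind P step
    where
    P : Subset n → Set
    P S = (∀ {s} → s ∈ S → r (X ∪ ⁅ s ⁆) ≤ r X) → r (X ∪ S) ≤ r X
    step : ∀ S → (∀ {s} → s ∈ S → P (S - s)) → P S
    step S ih spans with nonempty? S
    ... | no S-empty rewrite Empty-unique S-empty | ∪-identityʳ X = ≤-refl
    ... | yes (s , s∈S) = +-cancelʳ-≤ (r X) _ _ (begin
      r (X ∪ S) + r X                 ≤⟨ submod-⊆ split (λ h → x∈p∩q⁺ (p⊆p∪q _ h , p⊆p∪q _ h)) ⟩
      r (X ∪ (S - s)) + r (X ∪ ⁅ s ⁆) ≤⟨ +-mono-≤ (ih s∈S (λ h → spans (p─q⊆p S ⁅ s ⁆ h))) (spans s∈S) ⟩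
      r X + r X                       ∎)
      where
      open ≤-Reasoning
      split : X ∪ S ⊆ (X ∪ (S - s)) ∪ (X ∪ ⁅ s ⁆)
      split {x} h with x∈p∪q⁻ X S h
      ... | inj₁ x∈X = x∈p∪q⁺ (inj₁ (p⊆p∪q _ x∈X))
      ... | inj₂ x∈S with x ∈? ⁅ s ⁆
      ...   | yes x∈⁅s⁆ = x∈p∪q⁺ (inj₂ (q⊆p∪q X _ x∈⁅s⁆))
      ...   | no  x∉⁅s⁆ = x∈p∪q⁺ (inj₁ (q⊆p∪q X _ (x∈p∧x∉q⇒x∈p─q x∈S x∉⁅s⁆)))

  cl : Subset n → Subset n
  cl X = select (λ e → r (X ∪ ⁅ e ⁆) ≤? r X)

  ⊆cl : ∀ X → X ⊆ cl X
  ⊆cl X x∈X = select⁺ (λ e → r (X ∪ ⁅ e ⁆) ≤? r X) (rank-⊆ (∪⁅⁆⊆ x∈X id))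

  rank-cl : ∀ X → r (cl X) ≤ r X
  rank-cl X = ≤-trans (rank-⊆ (q⊆p∪q X (cl X)))
                      (spans-union X (cl X) (select⁻ (λ e → r (X ∪ ⁅ e ⁆) ≤? r X)))

  cl-flat : ∀ X → Flat M (cl X)
  cl-flat X e e∉cl = begin-strict
    r (cl X)         ≤⟨ rank-cl X ⟩
    r X              <⟨ ≰⇒> (λ spanned → e∉cl (select⁺ (λ e → r (X ∪ ⁅ e ⁆) ≤? r X) spanned)) ⟩
    r (X ∪ ⁅ e ⁆)    ≤⟨ rank-⊆ (∪⁅⁆⊆ x∈p∪⁅x⁆ (λ h → p⊆p∪q ⁅ e ⁆ (⊆cl X h))) ⟩
    r (cl X ∪ ⁅ e ⁆) ∎
    where open ≤-Reasoning

  rank-formula : ∀ X → Σ (Subset n) λ Z → CyclicFlat M Z × r Z + ∣ X ─ Z ∣ ≤ r X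
  rank-formula X = Z , cyc-cyclicFlat (cl-flat X) , (begin
    r Z + ∣ X ─ Z ∣      ≤⟨ +-monoʳ-≤ (r Z) (p⊆q⇒∣p∣≤∣q∣ (─-monoˡ {s = Z} (⊆cl X))) ⟩
    r Z + ∣ cl X ─ Z ∣   ≡⟨ rank-cyc (cl X) ⟩
    r (cl X)             ≤⟨ rank-cl X ⟩
    r X                  ∎)
    where
    open ≤-Reasoning
    Z = cyc (cl X)

  nullity+rank : ∀ X → nullity M X + r X ≡ ∣ X ∣
  nullity+rank X = m∸n+n≡m (rank-≤-card M X)

  flat-absorbs : ∀ {F Z} → Flat M F → r Z ≤ r (Z ∩ F) → Z ⊆ F
  flat-absorbs {F} {Z} flat-F spanned {e} e∈Z with e ∈? F
  ... | yes e∈F = e∈F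
  ... | no  e∉F = contradiction (+-cancelʳ-≤ (r (Z ∩ F)) _ _ (begin
    r (F ∪ ⁅ e ⁆) + r (Z ∩ F) ≤⟨ submod-⊆ (∪⁅⁆⊆ (q⊆p∪q F Z e∈Z) (p⊆p∪q Z)) ∩-swap ⟩
    r F + r Z                 ≤⟨ +-monoʳ-≤ (r F) spanned ⟩
    r F + r (Z ∩ F)           ∎)) (<⇒≱ (flat-F e e∉F))
    where
    open ≤-Reasoning
    ∩-swap : Z ∩ F ⊆ F ∩ Z
    ∩-swap h = let (x∈Z , x∈F) = x∈p∩q⁻ Z F h in x∈p∩q⁺ (x∈F , x∈Z)

  -- Z is abundant for F when null(F) + r Z ≤ |Z ∩ F|.  Abundant sets of a flat
  -- F lie inside F: counting gives r Z ≤ r (Z ∩ F).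
  abundant⇒⊆ : ∀ {F Z} → Flat M F → nullity M F + r Z ≤ ∣ Z ∩ F ∣ → Z ⊆ F
  abundant⇒⊆ {F} {Z} flat-F abundant = flat-absorbs flat-F
    (+-cancelˡ-≤ ν _ _ (+-cancelʳ-≤ ∣ F ─ Z ∣ _ _ (begin
      ν + r Z + ∣ F ─ Z ∣         ≤⟨ +-monoˡ-≤ _ abundant ⟩
      ∣ Z ∩ F ∣ + ∣ F ─ Z ∣       ≡⟨ ∣∩∣+∣─∣ F Z ⟩
      ∣ F ∣                       ≡⟨ sym (nullity+rank F) ⟩
      ν + r F                     ≤⟨ +-monoʳ-≤ ν (rank-split F Z) ⟩
      ν + (r (Z ∩ F) + ∣ F ─ Z ∣) ≡⟨ sym (+-assoc ν _ _) ⟩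
      ν + r (Z ∩ F) + ∣ F ─ Z ∣   ∎)))
    where
    open ≤-Reasoning
    ν = nullity M F

  -- An abundant Z ⊆ F contains cyc F: an element of F spanned by F - e but
  -- missing from Z would make F - e too large.
  cyc⊆abundant : ∀ {F Z} → Z ⊆ F → nullity M F + r Z ≤ ∣ Z ∣ → cyc F ⊆ Z
  cyc⊆abundant {F} {Z} Z⊆F abundant {e} e∈cyc with e ∈? Z
  ... | yes e∈Z = e∈Z
  ... | no  e∉Z = contradiction (begin-strict
    ν + r F                   ≤⟨ +-monoʳ-≤ ν (≤-trans (proj₂ (cyc⁻ e∈cyc)) (rank-≤ (F - e) Z)) ⟩
    ν + (r Z + ∣ F - e ─ Z ∣) ≡⟨ sym (+-assoc ν _ _) ⟩
    ν + r Z + ∣ F - e ─ Z ∣   ≤⟨ +-monoˡ-≤ _ abundant ⟩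
    ∣ Z ∣ + ∣ F - e ─ Z ∣     ≡⟨ ⊆⇒∣∣+∣─∣ (⊆-─⁅⁆ Z⊆F e∉Z) ⟩
    ∣ F - e ∣                 <⟨ x∈p⇒∣p-x∣<∣p∣ (cyc⊆ e∈cyc) ⟩
    ∣ F ∣                     ≡⟨ sym (nullity+rank F) ⟩
    ν + r F                   ∎) (<-irrefl refl)
    where
    open ≤-Reasoning
    ν = nullity M F

  abundant⇒≡cyc : ∀ {F Z} → Flat M F → IsCyc M Z Z → nullity M F + r Z ≤ ∣ Z ∩ F ∣ → Z ≡ cyc F
  abundant⇒≡cyc {F} {Z} flat-F Z-cyclic abundant =
    ⊆-antisym Z⊆cyc (cyc⊆abundant Z⊆F (≤-trans abundant (∣p∩q∣≤∣p∣ Z F)))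
    where
    Z⊆F : Z ⊆ F
    Z⊆F = abundant⇒⊆ flat-F abundant
    Z⊆cyc : Z ⊆ cyc F
    Z⊆cyc {e} e∈Z = let (C , circuit , C⊆Z , e∈C) = proj₁ (Z-cyclic e) e∈Z in
      circuit⊆cyc circuit (λ h → Z⊆F (C⊆Z h)) e∈C

  -- cyc F is abundant for F: deleting coloops preserves the nullity.
  cyc-abundant : ∀ F → nullity M F + r (cyc F) ≤ ∣ cyc F ∩ F ∣
  cyc-abundant F = begin
    ν + r C     ≡⟨ +-cancelʳ-≡ ∣ F ─ C ∣ _ _ same-nullity ⟩
    ∣ C ∣       ≤⟨ p⊆q⇒∣p∣≤∣q∣ (λ h → x∈p∩q⁺ (h , cyc⊆ h)) ⟩
    ∣ C ∩ F ∣   ∎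
    where
    open ≤-Reasoning
    ν = nullity M F
    C = cyc F
    same-nullity : ν + r C + ∣ F ─ C ∣ ≡ ∣ C ∣ + ∣ F ─ C ∣
    same-nullity = begin-equality
      ν + r C + ∣ F ─ C ∣   ≡⟨ +-assoc ν _ _ ⟩
      ν + (r C + ∣ F ─ C ∣) ≡⟨ cong (ν +_) (rank-cyc F) ⟩
      ν + r F               ≡⟨ nullity+rank F ⟩
      ∣ F ∣                 ≡⟨ sym (⊆⇒∣∣+∣─∣ cyc⊆) ⟩
      ∣ C ∣ + ∣ F ─ C ∣     ∎

-- Consequences of N being a cyclic reduction of M.

module Reduction {n : ℕ} (M N : Matroid n) (reduction : CyclicReduction N M) where

  private
    N⇒M : ∀ Z → CyclicFlat N Z → CyclicFlat M Z
    N⇒M = proj₁ (proj₂ (proj₂ reduction))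
    same-rank : ∀ Z → CyclicFlat N Z → rank N Z ≡ rank M Z
    same-rank = proj₂ (proj₂ (proj₂ reduction))

  -- Ranks can only drop from N to M (rank formula for N).
  rank-≤-reduction : ∀ X → rank M X ≤ rank N X
  rank-≤-reduction X = begin
    rank M X             ≤⟨ rank-≤ M X Z ⟩
    rank M Z + ∣ X ─ Z ∣ ≡⟨ cong (_+ ∣ X ─ Z ∣) (sym (same-rank Z Z-cyclicN)) ⟩
    rank N Z + ∣ X ─ Z ∣ ≤⟨ bound ⟩
    rank N X             ∎
    where
    open ≤-Reasoning
    Z : Subset n
    Z = proj₁ (rank-formula N X)
    Z-cyclicN : CyclicFlat N Z
    Z-cyclicN = proj₁ (proj₂ (rank-formula N X))
    bound : rank N Z + ∣ X ─ Z ∣ ≤ rank N X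
    bound = proj₂ (proj₂ (rank-formula N X))

  module AtFlat {F : Subset n} (flat-N : Flat N F) where

    private
      C : Subset n
      C = cyc N F
      ν : ℕ
      ν = nullity N F

    C-cyclicN : CyclicFlat N C
    C-cyclicN = cyc-cyclicFlat N {F} flat-N

    C-abundant : Abundant M N F C
    C-abundant = N⇒M C C-cyclicN
               , subst (λ x → ν + x ≤ ∣ C ∩ F ∣) (same-rank C C-cyclicN) (cyc-abundant N F)

    -- An abundant flat that is also cyclic in N is abundant in N, hence C.
    abundant-cyclicN⇒≡C : ∀ {Z} → Abundant M N F Z → CyclicFlat N Z → Z ≡ C
    abundant-cyclicN⇒≡C {Z} (_ , abundant) Z-cyclicN = abundant⇒≡cyc N flat-N (proj₂ Z-cyclicN)
      (subst (λ x → ν + x ≤ ∣ Z ∩ F ∣) (sym (same-rank Z Z-cyclicN)) abundant)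

    abundant∖witness⇔cyc : ∀ Z → (Abundant M N F Z × ¬ Witness M N F Z) ⇔ IsCyc N F Z
    abundant∖witness⇔cyc Z = mk⇔
      (λ (abundant , not-witness) → subst (IsCyc N F) (sym (Z≡C abundant not-witness)) (cyc-isCyc N F))
      (λ Z-isCyc → subst (λ Y → Abundant M N F Y × ¬ Witness M N F Y) (sym (isCyc⇒≡cyc N Z-isCyc))
                         (C-abundant , λ C-witness → proj₂ C-witness C-cyclicN))
      where
      Z≡C : Abundant M N F Z → ¬ Witness M N F Z → Z ≡ C
      Z≡C abundant not-witness = decidable-stable (≡-dec Bool._≟_ Z C)
        (λ Z≢C → not-witness (abundant , λ Z-cyclicN → Z≢C (abundant-cyclicN⇒≡C abundant Z-cyclicN)))

    -- If F is a flat of M of the same rank, then ν is also its nullity in M,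
    -- so every witness and C itself are both cyc_M(F), a contradiction.
    flat⇒no-witness : Flat M F → rank M F ≡ rank N F → ∀ Z → ¬ Witness M N F Z
    flat⇒no-witness flat-M same-rank-F Z ((Z-cyclicM , abundant) , not-cyclicN) =
      not-cyclicN (subst (CyclicFlat N) (sym Z≡C) C-cyclicN)
      where
      in-M : ∀ {Y} → ν + rank M Y ≤ ∣ Y ∩ F ∣ → nullity M F + rank M Y ≤ ∣ Y ∩ F ∣
      in-M {Y} = subst (λ x → x + rank M Y ≤ ∣ Y ∩ F ∣) (cong (∣ F ∣ ∸_) (sym same-rank-F))
      Z≡C : Z ≡ C
      Z≡C = trans (abundant⇒≡cyc M flat-M (proj₂ Z-cyclicM) (in-M abundant))
                  (sym (abundant⇒≡cyc M flat-M (proj₂ (proj₁ C-abundant)) (in-M (proj₂ C-abundant))))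

    -- Without witnesses, a set X ⊇ F keeps its N-rank in M or has M-rank
    -- above rank_N F: apply the rank formula of M to X and ask whether the
    -- resulting cyclic flat is abundant.
    no-witness⇒rank-bound : (∀ Z → ¬ Witness M N F Z) → ∀ X → F ⊆ X →
                            rank N X ≤ rank M X ⊎ rank N F < rank M X
    no-witness⇒rank-bound no-witness X F⊆X = by-abundance (ν + rank M Z ≤? ∣ Z ∩ F ∣)
      where
      open ≤-Reasoning
      Z : Subset n
      Z = proj₁ (rank-formula M X)
      Z-cyclicM : CyclicFlat M Z
      Z-cyclicM = proj₁ (proj₂ (rank-formula M X))
      bound : rank M Z + ∣ X ─ Z ∣ ≤ rank M X
      bound = proj₂ (proj₂ (rank-formula M X))
      -- an abundant Z is no witness, so it is cyclic in N and bounds rank_N X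
      -- from above; a non-abundant Z forces rank_M X above rank_N F
      by-abundance : Dec (ν + rank M Z ≤ ∣ Z ∩ F ∣) → rank N X ≤ rank M X ⊎ rank N F < rank M X
      by-abundance (yes abundant) = inj₁ (decidable-stable (rank N X ≤? rank M X) λ ρX≰rX →
        no-witness Z ((Z-cyclicM , abundant) , λ Z-cyclicN → ρX≰rX (begin
          rank N X             ≤⟨ rank-≤ N X Z ⟩
          rank N Z + ∣ X ─ Z ∣ ≡⟨ cong (_+ ∣ X ─ Z ∣) (same-rank Z Z-cyclicN) ⟩
          rank M Z + ∣ X ─ Z ∣ ≤⟨ bound ⟩
          rank M X             ∎)))
      by-abundance (no not-abundant) = inj₂ (+-cancelˡ-≤ ν _ _ (begin
        ν + suc (rank N F)          ≡⟨ +-suc ν _ ⟩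
        suc (ν + rank N F)          ≡⟨ cong suc (nullity+rank N F) ⟩
        suc ∣ F ∣                   ≡⟨ cong suc (sym (∣∩∣+∣─∣ F Z)) ⟩
        suc (∣ Z ∩ F ∣ + ∣ F ─ Z ∣) ≤⟨ +-monoˡ-≤ _ (≰⇒> not-abundant) ⟩
        ν + rank M Z + ∣ F ─ Z ∣    ≤⟨ +-monoʳ-≤ _ (p⊆q⇒∣p∣≤∣q∣ (─-monoˡ {s = Z} F⊆X)) ⟩
        ν + rank M Z + ∣ X ─ Z ∣    ≡⟨ +-assoc ν _ _ ⟩
        ν + (rank M Z + ∣ X ─ Z ∣)  ≤⟨ +-monoʳ-≤ ν bound ⟩
        ν + rank M X                ∎))

    no-witness⇒flat : (∀ Z → ¬ Witness M N F Z) → Flat M F × rank M F ≡ rank N F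
    no-witness⇒flat no-witness = flat-M , ≤-antisym (rank-≤-reduction F) ρF≤rF
      where
      bound = no-witness⇒rank-bound no-witness
      ρF≤rF : rank N F ≤ rank M F
      ρF≤rF = [ id , <⇒≤ ]′ (bound F id)
      flat-M : Flat M F
      flat-M e e∉F with bound (F ∪ ⁅ e ⁆) (p⊆p∪q ⁅ e ⁆)
      ... | inj₁ ρ≤r = begin-strict
        rank M F             ≤⟨ rank-≤-reduction F ⟩
        rank N F             <⟨ flat-N e e∉F ⟩
        rank N (F ∪ ⁅ e ⁆)   ≤⟨ ρ≤r ⟩
        rank M (F ∪ ⁅ e ⁆)   ∎
        where open ≤-Reasoning
      ... | inj₂ ρF<r = ≤-<-trans (rank-≤-reduction F) ρF<r

proposition3p9 : {n : ℕ} (M N : Matroid n) → CyclicReduction N M →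
    (F : Subset n) (k : ℕ) → Flat N F → rank N F ≡ k →
    (∀ Z → (Abundant M N F Z × ¬ Witness M N F Z) ⇔ IsCyc N F Z)
    × ((Flat M F × rank M F ≡ k) ⇔ (∀ Z → ¬ Witness M N F Z))
proposition3p9 M N reduction F _ flat-N refl =
    abundant∖witness⇔cyc
  , mk⇔ (uncurry flat⇒no-witness) no-witness⇒flat
  where
  open Reduction M N reduction
  open AtFlat flat-N
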